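{- For every positive integer $k$ there exists a bipartite graph $G$ such that $\mu_{\mathrm{int}}(G)=k$.
   Context: Graphs are finite and simple. A $k$-improper edge coloring of a graph $G$ is a map $\alpha:E(G)\to\mathbb{N}$ such that at most $k$ edges with a common endpoint receive the same color; it is an improper interval coloring if at every vertex the colors on incident edges form a set of consecutive integers. The interval coloring impropriety $\mu_{\mathrm{int}}(G)$ is the smallest $k$ such that $G$ has a $k$-improper interval edge coloring. -}

module Defs where

open import Data.Nat using (ℕ; _≤_; _≡ᵇ_)
open import Data.Bool using (Bool; true; false; _∧_)
open import Data.Fin using (Fin)
open import Data.List using (length; filterᵇ; allFin)
open import Data.Product using (Σ; ∃; _×_)
open import Relation.Binary.PropositionalEquality using (_≡_; _≢_)

record Graph (n : ℕ) : Set where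
  field
    adj    : Fin n → Fin n → Bool
    sym    : ∀ u v → adj u v ≡ adj v u
    irrefl : ∀ v → adj v v ≡ false
open Graph public

IsBipartite : ∀ {n} → Graph n → Set
IsBipartite {n} G =
  Σ (Fin n → Bool) λ side → ∀ u v → adj G u v ≡ true → side u ≢ side v

-- An edge colouring α : E(G) → ℕ, represented as a function on ordered
-- vertex pairs that is symmetric on edges (values on non-edges are
-- irrelevant).
record EdgeColouring {n : ℕ} (G : Graph n) : Set where
  field
    col     : Fin n → Fin n → ℕ
    col-sym : ∀ u v → adj G u v ≡ true → col u v ≡ col v u
open EdgeColouring public

countAt : ∀ {n} {G : Graph n} → EdgeColouring G → Fin n → ℕ → ℕ
countAt {n} {G} α v c =
  length (filterᵇ (λ u → adj G v u ∧ (col α v u ≡ᵇ c)) (allFin n))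

IsImproper : ∀ {n} {G : Graph n} → ℕ → EdgeColouring G → Set
IsImproper {n} k α = ∀ (v : Fin n) (c : ℕ) → countAt α v c ≤ k

IsInterval : ∀ {n} {G : Graph n} → EdgeColouring G → Set
IsInterval {n} {G} α =
  ∀ (v u w : Fin n) (c : ℕ) →
    adj G v u ≡ true → adj G v w ≡ true →
    col α v u ≤ c → c ≤ col α v w →
    ∃ λ x → adj G v x ≡ true × col α v x ≡ c

HasImproperInterval : ∀ {n} → Graph n → ℕ → Set
HasImproperInterval G k =
  Σ (EdgeColouring G) λ α → IsImproper k α × IsInterval α

μint≡ : ∀ {n} → Graph n → ℕ → Set
μint≡ G k = HasImproperInterval G k × (∀ j → HasImproperInterval G j → k ≤ j)

-- Take a root joined to h hubs, give each hub k private leaves, and join every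
-- leaf to a common sink. Colouring root–hub t and leaf–sink edges by t + 1 and
-- hub–leaf edges by t is a k-improper interval colouring. Conversely, in an
-- interval colouring the colours at a vertex of degree d span at most d
-- consecutive values, so walking sink → leaf → hub → root shows that all h k
-- sink colours lie in a window of h + 2k + 2 colours around the least root
-- colour; if the colouring is j-improper then h k ≤ (h + 2k + 2) j, which
-- forces j ≥ k once h = (2k + 2)(k − 1) + 2.
module Submission where

open import Data.Bool using (Bool; true; false; _∧_; _∨_; if_then_else_)
open import Data.Bool.Properties using (∧-distribˡ-∨; ∧-conicalˡ; ∧-conicalʳ)
open import Data.Empty using (⊥; ⊥-elim)
open import Data.Fin using (Fin; zero; suc; toℕ; _↑ˡ_; _↑ʳ_; splitAt; join; combine; remQuot)
open import Data.Fin.Properties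
  using (toℕ-injective; toℕ<n; toℕ-fromℕ<; splitAt-↑ˡ; splitAt-↑ʳ; join-splitAt;
         remQuot-combine; combine-remQuot)
open import Data.List using (List; []; _∷_; length; filterᵇ; allFin; map)
open import Data.List.Properties using (map-tabulate; length-map; length-tabulate)
open import Data.List.Membership.Propositional using (_∈_)
open import Data.List.Membership.Propositional.Properties using (∈-map⁺; ∈-allFin)
open import Data.List.Relation.Unary.Any using (here; there)
import Data.List.Relation.Unary.All as All
open import Data.Nat
open import Data.Nat.DivMod using (_mod_; m<n⇒m%n≡m)
open import Data.Nat.Properties
open import Data.List.Extrema ≤-totalOrder using (argmin; f[argmin]≤f[xs])
open import Data.Nat.Tactic.RingSolver using (solve-∀)
open import Data.Product using (Σ; ∃; _×_; _,_; proj₁; proj₂)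
open import Data.Sum using (_⊎_; inj₁; inj₂)
open import Function using (_∘_; id)
open import Relation.Binary.PropositionalEquality
open import Defs hiding (sym)

private
  variable
    A : Set

≡ᵇ-true⇒≡ : ∀ {m n} → (m ≡ᵇ n) ≡ true → m ≡ n
≡ᵇ-true⇒≡ {zero}  {zero}  _ = refl
≡ᵇ-true⇒≡ {suc m} {suc n} e = cong suc (≡ᵇ-true⇒≡ e)

≡⇒≡ᵇ-true : ∀ {m n} → m ≡ n → (m ≡ᵇ n) ≡ true
≡⇒≡ᵇ-true {zero}  refl = refl
≡⇒≡ᵇ-true {suc m} refl = ≡⇒≡ᵇ-true {m} refl

1+n≡ᵇn : ∀ n → (suc n ≡ᵇ n) ≡ false
1+n≡ᵇn zero    = refl
1+n≡ᵇn (suc n) = 1+n≡ᵇn n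

count : (A → Bool) → List A → ℕ
count P xs = length (filterᵇ P xs)

count-cong : ∀ {P Q : A → Bool} → (∀ x → P x ≡ Q x) → ∀ xs → count P xs ≡ count Q xs
count-cong P≗Q []       = refl
count-cong {P = P} {Q} P≗Q (x ∷ xs) rewrite P≗Q x with Q x
... | true  = cong suc (count-cong P≗Q xs)
... | false = count-cong P≗Q xs

count-mono : ∀ {P Q : A → Bool} → (∀ x → P x ≡ true → Q x ≡ true) → ∀ xs → count P xs ≤ count Q xs
count-mono P⇒Q [] = z≤n
count-mono {P = P} {Q} P⇒Q (x ∷ xs) with P x in Px | Q x in Qx
... | true  | true  = s≤s (count-mono P⇒Q xs)
... | true  | false with () ← trans (sym Qx) (P⇒Q x Px)
... | false | true  = m≤n⇒m≤1+n (count-mono P⇒Q xs)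
... | false | false = count-mono P⇒Q xs

count-∷ : ∀ (P : A → Bool) x xs → count P (x ∷ xs) ≡ count P (x ∷ []) + count P xs
count-∷ P x xs with P x
... | true  = refl
... | false = refl

count-map : ∀ {B : Set} (P : B → Bool) (f : A → B) xs → count P (map f xs) ≡ count (P ∘ f) xs
count-map P f []       = refl
count-map P f (x ∷ xs) with P (f x)
... | true  = cong suc (count-map P f xs)
... | false = count-map P f xs

count-∈ : ∀ (P : A → Bool) {x xs} → x ∈ xs → P x ≡ true → 0 < count P xs
count-∈ P (here refl) Px rewrite Px = s≤s z≤n
count-∈ P {xs = y ∷ _} (there x∈xs) Px with P y
... | true  = s≤s z≤n
... | false = count-∈ P x∈xs Px

count-∨-≤ : ∀ (P Q : A → Bool) xs → count (λ x → P x ∨ Q x) xs ≤ count P xs + count Q xs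
count-∨-≤ P Q []       = z≤n
count-∨-≤ P Q (x ∷ xs) with P x | Q x
... | true  | true  = s≤s (≤-trans (count-∨-≤ P Q xs) (+-monoʳ-≤ (count P xs) (n≤1+n _)))
... | true  | false = s≤s (count-∨-≤ P Q xs)
... | false | true  = ≤-trans (s≤s (count-∨-≤ P Q xs)) (≤-reflexive (sym (+-suc _ _)))
... | false | false = count-∨-≤ P Q xs

count-∨-disjoint : ∀ (P Q : A → Bool) → (∀ x → P x ≡ true → Q x ≡ true → ⊥) →
                   ∀ xs → count P xs + count Q xs ≤ count (λ x → P x ∨ Q x) xs
count-∨-disjoint P Q disj []       = z≤n
count-∨-disjoint P Q disj (x ∷ xs) with P x in Px | Q x in Qx
... | true  | true  = ⊥-elim (disj x Px Qx)
... | true  | false = s≤s (count-∨-disjoint P Q disj xs)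
... | false | true  = ≤-trans (≤-reflexive (+-suc _ _)) (s≤s (count-∨-disjoint P Q disj xs))
... | false | false = count-∨-disjoint P Q disj xs

inRange : ℕ → ℕ → ℕ → Bool
inRange m zero    x = x ≡ᵇ m
inRange m (suc S) x = (x ≡ᵇ m) ∨ inRange (suc m) S x

inRange⇒≤ : ∀ m S x → inRange m S x ≡ true → m ≤ x
inRange⇒≤ m zero    x x∈ = ≤-reflexive (sym (≡ᵇ-true⇒≡ x∈))
inRange⇒≤ m (suc S) x x∈ with x ≡ᵇ m in x≡m
... | true  = ≤-reflexive (sym (≡ᵇ-true⇒≡ x≡m))
... | false = ≤-trans (n≤1+n m) (inRange⇒≤ (suc m) S x x∈)

inRange-intro : ∀ m S x → m ≤ x → x ≤ m + S → inRange m S x ≡ true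
inRange-intro m zero    x m≤x x≤m = ≡⇒≡ᵇ-true (≤-antisym (≤-trans x≤m (≤-reflexive (+-identityʳ m))) m≤x)
inRange-intro m (suc S) x m≤x x≤m+S with x ≡ᵇ m in x≡m | m≤n⇒m<n∨m≡n m≤x
... | true  | _          = refl
... | false | inj₁ m<x   = inRange-intro (suc m) S x m<x (≤-trans x≤m+S (≤-reflexive (+-suc m S)))
... | false | inj₂ refl with () ← trans (sym (≡⇒≡ᵇ-true {m} refl)) x≡m

module _ (P : A → Bool) (g : A → ℕ) (xs : List A) where

  countInRange : ℕ → ℕ → ℕ
  countInRange m S = count (λ x → P x ∧ inRange m S (g x)) xs

  countValue : ℕ → ℕ
  countValue c = count (λ x → P x ∧ (g x ≡ᵇ c)) xs

  countInRange-suc : ∀ m S →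
    countInRange m (suc S) ≡ count (λ x → (P x ∧ (g x ≡ᵇ m)) ∨ (P x ∧ inRange (suc m) S (g x))) xs
  countInRange-suc m S = count-cong (λ x → ∧-distribˡ-∨ (P x) _ _) xs

  countInRange-≤ : ∀ {j} → (∀ c → countValue c ≤ j) → ∀ m S → countInRange m S ≤ suc S * j
  countInRange-≤ {j} bound m zero    = ≤-trans (bound m) (≤-reflexive (sym (+-identityʳ j)))
  countInRange-≤ {j} bound m (suc S) = begin
    countInRange m (suc S)                 ≡⟨ countInRange-suc m S ⟩
    count (λ x → (P x ∧ (g x ≡ᵇ m)) ∨ (P x ∧ inRange (suc m) S (g x))) xs
                                           ≤⟨ count-∨-≤ _ _ xs ⟩
    countValue m + countInRange (suc m) S  ≤⟨ +-mono-≤ (bound m) (countInRange-≤ bound (suc m) S) ⟩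
    j + suc S * j                          ∎
    where open ≤-Reasoning

  countValue-pos : ∀ {c} → (∃ λ x → x ∈ xs × P x ≡ true × g x ≡ c) → 0 < countValue c
  countValue-pos (x , x∈xs , Px , gx≡c) = count-∈ _ x∈xs (cong₂ _∧_ Px (≡⇒≡ᵇ-true gx≡c))

  countInRange-≥ : ∀ m S → (∀ c → m ≤ c → c ≤ m + S → ∃ λ x → x ∈ xs × P x ≡ true × g x ≡ c) →
                   suc S ≤ countInRange m S
  countInRange-≥ m zero    hit = countValue-pos (hit m ≤-refl (m≤m+n m 0))
  countInRange-≥ m (suc S) hit = begin
    1 + suc S                              ≤⟨ +-mono-≤ (countValue-pos (hit m ≤-refl (m≤m+n m _)))
                                                       (countInRange-≥ (suc m) S hit′) ⟩
    countValue m + countInRange (suc m) S  ≤⟨ count-∨-disjoint _ _ disjoint xs ⟩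
    count (λ x → (P x ∧ (g x ≡ᵇ m)) ∨ (P x ∧ inRange (suc m) S (g x))) xs
                                           ≡⟨ sym (countInRange-suc m S) ⟩
    countInRange m (suc S)                 ∎
    where
    open ≤-Reasoning
    hit′ : ∀ c → suc m ≤ c → c ≤ suc m + S → ∃ λ x → x ∈ xs × P x ≡ true × g x ≡ c
    hit′ c m<c c≤ = hit c (≤-trans (n≤1+n m) m<c) (≤-trans c≤ (≤-reflexive (sym (+-suc m S))))
    disjoint : ∀ x → (P x ∧ (g x ≡ᵇ m)) ≡ true → (P x ∧ inRange (suc m) S (g x)) ≡ true → ⊥
    disjoint x gx≡m gx∈ = 1+n≰n (≤-trans (inRange⇒≤ (suc m) S (g x) (∧-conicalʳ _ _ gx∈))
                                          (≤-reflexive (≡ᵇ-true⇒≡ (∧-conicalʳ _ _ gx≡m))))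

allFin-suc : ∀ n → allFin (suc n) ≡ zero ∷ map suc (allFin n)
allFin-suc n = cong (zero ∷_) (sym (map-tabulate id suc))

count-allFin-suc : ∀ {n} (P : Fin (suc n) → Bool) →
                   count P (allFin (suc n)) ≡ count P (zero ∷ []) + count (P ∘ suc) (allFin n)
count-allFin-suc {n} P = begin
  count P (allFin (suc n))                           ≡⟨ cong (count P) (allFin-suc n) ⟩
  count P (zero ∷ map suc (allFin n))                ≡⟨ count-∷ P zero _ ⟩
  count P (zero ∷ []) + count P (map suc (allFin n)) ≡⟨ cong (count P (zero ∷ []) +_)
                                                             (count-map P suc (allFin n)) ⟩
  count P (zero ∷ []) + count (P ∘ suc) (allFin n)   ∎
  where open ≡-Reasoning

length-map-allFin : ∀ {n} (f : Fin n → A) → length (map f (allFin n)) ≡ n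
length-map-allFin {n = n} f = trans (length-map f (allFin n)) (length-tabulate id)

strip : ∀ {n} → List (Fin (suc n)) → List (Fin n)
strip []          = []
strip (zero  ∷ L) = strip L
strip (suc i ∷ L) = i ∷ strip L

length-strip : ∀ {n} (L : List (Fin (suc n))) → length (strip L) ≤ length L
length-strip []          = z≤n
length-strip (zero  ∷ L) = m≤n⇒m≤1+n (length-strip L)
length-strip (suc i ∷ L) = s≤s (length-strip L)

length-strip-∈ : ∀ {n} {L : List (Fin (suc n))} → zero ∈ L → length (strip L) < length L
length-strip-∈ {L = zero  ∷ L} _            = s≤s (length-strip L)
length-strip-∈ {L = suc i ∷ L} (there 0∈L) = s≤s (length-strip-∈ 0∈L)

∈-strip : ∀ {n} {L : List (Fin (suc n))} {i} → suc i ∈ L → i ∈ strip L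
∈-strip {L = zero  ∷ L} (there i∈L) = ∈-strip i∈L
∈-strip {L = suc j ∷ L} (here refl) = here refl
∈-strip {L = suc j ∷ L} (there i∈L) = there (∈-strip i∈L)

count-allFin≤length : ∀ n (P : Fin n → Bool) (L : List (Fin n)) →
                      (∀ i → P i ≡ true → i ∈ L) → count P (allFin n) ≤ length L
count-allFin≤length zero    P L _     = z≤n
count-allFin≤length (suc n) P L cover = begin
  count P (allFin (suc n))                          ≡⟨ count-allFin-suc P ⟩
  count P (zero ∷ []) + count (P ∘ suc) (allFin n)  ≤⟨ +-monoʳ-≤ (count P (zero ∷ [])) rest ⟩
  count P (zero ∷ []) + length (strip L)            ≤⟨ head ⟩
  length L                                          ∎
  where
  open ≤-Reasoning
  rest : count (P ∘ suc) (allFin n) ≤ length (strip L)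
  rest = count-allFin≤length n (P ∘ suc) (strip L) (λ i Pi → ∈-strip (cover (suc i) Pi))
  head : count P (zero ∷ []) + length (strip L) ≤ length L
  head with P zero in P0
  ... | true  = length-strip-∈ (cover zero P0)
  ... | false = length-strip L

count-allFin-↑ˡ : ∀ a b (P : Fin (a + b) → Bool) → (∀ i → P (i ↑ˡ b) ≡ true) →
                  a ≤ count P (allFin (a + b))
count-allFin-↑ˡ zero    b P _   = z≤n
count-allFin-↑ˡ (suc a) b P hit rewrite count-allFin-suc P | hit zero =
  s≤s (count-allFin-↑ˡ a b (P ∘ suc) (hit ∘ suc))

degree : ∀ {n} → Graph n → Fin n → ℕ
degree {n} G v = count (adj G v) (allFin n)

module _ {n} {G : Graph n} (α : EdgeColouring G) where

  improper-window : ∀ {j} → IsImproper j α → ∀ v m S →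
                    count (λ u → adj G v u ∧ inRange m S (col α v u)) (allFin n) ≤ suc S * j
  improper-window imp v = countInRange-≤ (adj G v) (col α v) (allFin n) (imp v)

  interval-spread : IsInterval α → ∀ {v a b d} → degree G v ≤ suc d →
                    adj G v a ≡ true → adj G v b ≡ true → col α v b ≤ col α v a + d
  interval-spread int {v} {a} {b} {d} deg≤ va vb with ≤-total (col α v a) (col α v b)
  ... | inj₂ b≤a = ≤-trans b≤a (m≤m+n _ d)
  ... | inj₁ a≤b = begin
    col α v b                             ≡⟨ sym (m+[n∸m]≡n a≤b) ⟩
    col α v a + (col α v b ∸ col α v a)   ≤⟨ +-monoʳ-≤ (col α v a)
                                                        (s≤s⁻¹ (≤-trans colours≤degree deg≤)) ⟩
    col α v a + d                         ∎
    where
    open ≤-Reasoning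
    m S : ℕ
    m = col α v a
    S = col α v b ∸ m
    hit : ∀ c → m ≤ c → c ≤ m + S → ∃ λ u → u ∈ allFin n × adj G v u ≡ true × col α v u ≡ c
    hit c m≤c c≤ with int v a b c va vb m≤c (≤-trans c≤ (≤-reflexive (m+[n∸m]≡n a≤b)))
    ... | u , vu , u↦c = u , ∈-allFin u , vu , u↦c
    colours≤degree : suc S ≤ degree G v
    colours≤degree = ≤-trans (countInRange-≥ (adj G v) (col α v) (allFin n) m S hit)
                             (count-mono (λ u → ∧-conicalˡ _ _) (allFin n))

toℕ-mod : ∀ {m c} .{{_ : NonZero m}} → c < m → toℕ (c mod m) ≡ c
toℕ-mod c<m = trans (toℕ-fromℕ< _) (m<n⇒m%n≡m c<m)

toℕ-mod-toℕ : ∀ {m} .{{_ : NonZero m}} (i : Fin m) → toℕ i mod m ≡ i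
toℕ-mod-toℕ i = toℕ-injective (toℕ-mod (toℕ<n i))

between-adjacent : ∀ {x c₁ c c₂} → x ≤ c₁ → c₂ ≤ suc x → c₁ ≤ c → c ≤ c₂ → c₁ ≡ c ⊎ c₂ ≡ c
between-adjacent x≤c₁ c₂≤1+x c₁≤c c≤c₂ with m≤n⇒m<n∨m≡n c₁≤c
... | inj₂ c₁≡c = inj₁ c₁≡c
... | inj₁ c₁<c = inj₂ (≤-antisym (≤-trans c₂≤1+x (≤-trans (s≤s x≤c₁) c₁<c)) c≤c₂)

module Construction (h′ k′ : ℕ) where

  h k : ℕ
  h = suc h′
  k = suc k′

  data Vertex : Set where
    root : Vertex
    hub  : Fin h → Vertex
    leaf : Fin h → Fin k → Vertex
    sink : Vertex

  adjV : Vertex → Vertex → Bool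
  adjV root       (hub _)     = true
  adjV (hub _)    root        = true
  adjV (hub t)    (leaf t′ _) = toℕ t′ ≡ᵇ toℕ t
  adjV (leaf t _) (hub t′)    = toℕ t ≡ᵇ toℕ t′
  adjV (leaf _ _) sink        = true
  adjV sink       (leaf _ _)  = true
  adjV _          _           = false

  adjV-sym : ∀ a b → adjV a b ≡ adjV b a
  adjV-sym root       root       = refl
  adjV-sym root       (hub _)    = refl
  adjV-sym root       (leaf _ _) = refl
  adjV-sym root       sink       = refl
  adjV-sym (hub _)    root       = refl
  adjV-sym (hub _)    (hub _)    = refl
  adjV-sym (hub _)    (leaf _ _) = refl
  adjV-sym (hub _)    sink       = refl
  adjV-sym (leaf _ _) root       = refl
  adjV-sym (leaf _ _) (hub _)    = refl
  adjV-sym (leaf _ _) (leaf _ _) = refl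
  adjV-sym (leaf _ _) sink       = refl
  adjV-sym sink       root       = refl
  adjV-sym sink       (hub _)    = refl
  adjV-sym sink       (leaf _ _) = refl
  adjV-sym sink       sink       = refl

  adjV-irrefl : ∀ a → adjV a a ≡ false
  adjV-irrefl root       = refl
  adjV-irrefl (hub _)    = refl
  adjV-irrefl (leaf _ _) = refl
  adjV-irrefl sink       = refl

  hub∼leaf : ∀ t s → adjV (hub t) (leaf t s) ≡ true
  hub∼leaf t _ = ≡⇒≡ᵇ-true {toℕ t} refl

  hub∼leaf⇒≡ : ∀ {t t′} s → adjV (hub t) (leaf t′ s) ≡ true → t′ ≡ t
  hub∼leaf⇒≡ _ e = toℕ-injective (≡ᵇ-true⇒≡ e)

  leaf∈leaves : ∀ {t t′ s} → adjV (hub t) (leaf t′ s) ≡ true → leaf t′ s ∈ map (leaf t) (allFin k)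
  leaf∈leaves {t} {s = s} e =
    subst (λ u → leaf u s ∈ map (leaf t) (allFin k)) (sym (hub∼leaf⇒≡ s e)) (∈-map⁺ (leaf t) (∈-allFin s))

  side : Vertex → Bool
  side root       = false
  side (hub _)    = true
  side (leaf _ _) = false
  side sink       = true

  side-adj : ∀ a b → adjV a b ≡ true → side a ≢ side b
  side-adj root       (hub _)    _ ()
  side-adj (hub _)    root       _ ()
  side-adj (hub _)    (leaf _ _) _ ()
  side-adj (leaf _ _) (hub _)    _ ()
  side-adj (leaf _ _) sink       _ ()
  side-adj sink       (leaf _ _) _ ()

  colV : Vertex → Vertex → ℕ
  colV root       (hub t)    = suc (toℕ t)
  colV (hub t)    root       = suc (toℕ t)
  colV (hub t)    (leaf _ _) = toℕ t
  colV (leaf t _) (hub _)    = toℕ t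
  colV (leaf t _) sink       = suc (toℕ t)
  colV sink       (leaf t _) = suc (toℕ t)
  colV _          _          = 0

  colV-sym : ∀ a b → adjV a b ≡ true → colV a b ≡ colV b a
  colV-sym root       (hub _)    _ = refl
  colV-sym (hub _)    root       _ = refl
  colV-sym (hub _)    (leaf _ s) e = cong toℕ (sym (hub∼leaf⇒≡ s e))
  colV-sym (leaf _ s) (hub _)    e = cong toℕ (hub∼leaf⇒≡ s e)
  colV-sym (leaf _ _) sink       _ = refl
  colV-sym sink       (leaf _ _) _ = refl

  n : ℕ
  n = h * k + suc (suc h)

  decode′ : Fin (h * k) ⊎ Fin (suc (suc h)) → Vertex
  decode′ (inj₁ i)             = leaf (proj₁ (remQuot {h} k i)) (proj₂ (remQuot {h} k i))
  decode′ (inj₂ zero)          = sink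
  decode′ (inj₂ (suc zero))    = root
  decode′ (inj₂ (suc (suc t))) = hub t

  decode : Fin n → Vertex
  decode i = decode′ (splitAt (h * k) i)

  encode : Vertex → Fin n
  encode root       = (h * k) ↑ʳ suc zero
  encode (hub t)    = (h * k) ↑ʳ suc (suc t)
  encode (leaf t s) = combine t s ↑ˡ suc (suc h)
  encode sink       = (h * k) ↑ʳ zero

  decode-encode : ∀ a → decode (encode a) ≡ a
  decode-encode root       = cong decode′ (splitAt-↑ʳ (h * k) (suc (suc h)) (suc zero))
  decode-encode (hub t)    = cong decode′ (splitAt-↑ʳ (h * k) (suc (suc h)) (suc (suc t)))
  decode-encode (leaf t s) = trans (cong decode′ (splitAt-↑ˡ (h * k) (combine t s) (suc (suc h))))
                                   (cong (λ (q , r) → leaf q r) (remQuot-combine {h} {k} t s))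
  decode-encode sink       = cong decode′ (splitAt-↑ʳ (h * k) (suc (suc h)) zero)

  encode-decode : ∀ i → encode (decode i) ≡ i
  encode-decode i = trans (encode-decode′ (splitAt (h * k) i)) (join-splitAt (h * k) (suc (suc h)) i)
    where
    encode-decode′ : ∀ x → encode (decode′ x) ≡ join (h * k) (suc (suc h)) x
    encode-decode′ (inj₁ i)             = cong (_↑ˡ suc (suc h)) (combine-remQuot {h} k i)
    encode-decode′ (inj₂ zero)          = refl
    encode-decode′ (inj₂ (suc zero))    = refl
    encode-decode′ (inj₂ (suc (suc t))) = refl

  G : Graph n
  G = record
    { adj    = λ i j → adjV (decode i) (decode j)
    ; sym    = λ i j → adjV-sym (decode i) (decode j)
    ; irrefl = adjV-irrefl ∘ decode
    }

  α : EdgeColouring G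
  α = record
    { col     = λ i j → colV (decode i) (decode j)
    ; col-sym = λ i j → colV-sym (decode i) (decode j)
    }

  bipartite : IsBipartite G
  bipartite = side ∘ decode , λ i j → side-adj (decode i) (decode j)

  adj-encode : ∀ a b → adjV a b ≡ true → adj G (encode a) (encode b) ≡ true
  adj-encode a b = subst₂ (λ x y → adjV x y ≡ true) (sym (decode-encode a)) (sym (decode-encode b))

  count-decode≤length : ∀ (P : Vertex → Bool) (L : List Vertex) →
                        (∀ w → P w ≡ true → w ∈ L) → count (P ∘ decode) (allFin n) ≤ length L
  count-decode≤length P L cover =
    ≤-trans (count-allFin≤length n (P ∘ decode) (map encode L) (λ i Pi → encode-∈ (cover (decode i) Pi)))
            (≤-reflexive (length-map encode L))
    where
    encode-∈ : ∀ {i} → decode i ∈ L → i ∈ map encode L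
    encode-∈ {i} i∈L = subst (_∈ map encode L) (encode-decode i) (∈-map⁺ encode i∈L)

  degree-encode : ∀ a (N : List Vertex) → (∀ w → adjV a w ≡ true → w ∈ N) → degree G (encode a) ≤ length N
  degree-encode a N cover = count-decode≤length (adjV (decode (encode a))) N
    (λ w e → cover w (subst (λ x → adjV x w ≡ true) (decode-encode a) e))

  hub-colours : ∀ t w → adjV (hub t) w ≡ true → toℕ t ≤ colV (hub t) w × colV (hub t) w ≤ suc (toℕ t)
  hub-colours t root       _ = n≤1+n _ , ≤-refl
  hub-colours t (leaf _ _) _ = ≤-refl , n≤1+n _

  leaf-colours : ∀ t s w → adjV (leaf t s) w ≡ true →
                 toℕ t ≤ colV (leaf t s) w × colV (leaf t s) w ≤ suc (toℕ t)
  leaf-colours t s (hub _) _ = ≤-refl , n≤1+n _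
  leaf-colours t s sink    _ = n≤1+n _ , ≤-refl

  intervalV : ∀ a b₁ b₂ c → adjV a b₁ ≡ true → adjV a b₂ ≡ true → colV a b₁ ≤ c → c ≤ colV a b₂ →
              Σ Vertex λ w → adjV a w ≡ true × colV a w ≡ c
  intervalV root (hub _) (hub t) (suc c) _ _ _ c≤t =
    hub (c mod h) , refl , cong suc (toℕ-mod (≤-<-trans (s≤s⁻¹ c≤t) (toℕ<n t)))
  intervalV sink (leaf _ _) (leaf t _) (suc c) _ _ _ c≤t =
    leaf (c mod h) zero , refl , cong suc (toℕ-mod (≤-<-trans (s≤s⁻¹ c≤t) (toℕ<n t)))
  intervalV (hub t) b₁ b₂ c e₁ e₂ b₁≤c c≤b₂
    with between-adjacent (proj₁ (hub-colours t b₁ e₁)) (proj₂ (hub-colours t b₂ e₂)) b₁≤c c≤b₂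
  ... | inj₁ b₁↦c = b₁ , e₁ , b₁↦c
  ... | inj₂ b₂↦c = b₂ , e₂ , b₂↦c
  intervalV (leaf t s) b₁ b₂ c e₁ e₂ b₁≤c c≤b₂
    with between-adjacent (proj₁ (leaf-colours t s b₁ e₁)) (proj₂ (leaf-colours t s b₂ e₂)) b₁≤c c≤b₂
  ... | inj₁ b₁↦c = b₁ , e₁ , b₁↦c
  ... | inj₂ b₂↦c = b₂ , e₂ , b₂↦c

  α-interval : IsInterval α
  α-interval v u w c e₁ e₂ u≤c c≤w with intervalV (decode v) (decode u) (decode w) c e₁ e₂ u≤c c≤w
  ... | x , vx , x↦c = encode x , subst (λ y → adjV (decode v) y ≡ true × colV (decode v) y ≡ c)
                                         (sym (decode-encode x)) (vx , x↦c)

  sameColour : Vertex → ℕ → List Vertex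
  sameColour root       zero    = []
  sameColour root       (suc c) = hub (c mod h) ∷ []
  sameColour (hub t)    c       = if c ≡ᵇ toℕ t then map (leaf t) (allFin k) else root ∷ []
  sameColour (leaf t _) c       = if c ≡ᵇ toℕ t then hub t ∷ [] else sink ∷ []
  sameColour sink       zero    = []
  sameColour sink       (suc c) = map (leaf (c mod h)) (allFin k)

  length-sameColour : ∀ a c → length (sameColour a c) ≤ k
  length-sameColour root       zero    = z≤n
  length-sameColour root       (suc c) = s≤s z≤n
  length-sameColour (hub t)    c with c ≡ᵇ toℕ t
  ... | true  = ≤-reflexive (length-map-allFin (leaf t))
  ... | false = s≤s z≤n
  length-sameColour (leaf t _) c with c ≡ᵇ toℕ t
  ... | true  = s≤s z≤n
  ... | false = s≤s z≤n
  length-sameColour sink       zero    = z≤n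
  length-sameColour sink       (suc c) = ≤-reflexive (length-map-allFin (leaf (c mod h)))

  ∈-sameColour : ∀ a w → adjV a w ≡ true → w ∈ sameColour a (colV a w)
  ∈-sameColour root (hub t) _ = here (cong hub (sym (toℕ-mod-toℕ t)))
  ∈-sameColour (hub t) root _ rewrite 1+n≡ᵇn (toℕ t) = here refl
  ∈-sameColour (hub t) (leaf t′ s) e rewrite ≡⇒≡ᵇ-true {toℕ t} refl = leaf∈leaves e
  ∈-sameColour (leaf t s) (hub t′) e rewrite ≡⇒≡ᵇ-true {toℕ t} refl =
    here (cong hub (sym (hub∼leaf⇒≡ s e)))
  ∈-sameColour (leaf t s) sink _ rewrite 1+n≡ᵇn (toℕ t) = here refl
  ∈-sameColour sink (leaf t s) _ rewrite toℕ-mod-toℕ t = ∈-map⁺ (leaf t) (∈-allFin s)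

  α-improper : IsImproper k α
  α-improper v c = ≤-trans (count-decode≤length _ (sameColour (decode v) c) cover)
                           (length-sameColour (decode v) c)
    where
    cover : ∀ w → (adjV (decode v) w ∧ (colV (decode v) w ≡ᵇ c)) ≡ true → w ∈ sameColour (decode v) c
    cover w e = subst (λ c′ → w ∈ sameColour (decode v) c′) (≡ᵇ-true⇒≡ (∧-conicalʳ _ _ e))
                      (∈-sameColour (decode v) w (∧-conicalˡ _ _ e))

  sinkWindow : ℕ
  sinkWindow = suc k + (h′ + suc k)

  module _ {j} (β : EdgeColouring G) (imp : IsImproper j β) (int : IsInterval β) where

    colour : Vertex → Vertex → ℕ
    colour a b = col β (encode a) (encode b)

    colour-sym : ∀ a b → adjV a b ≡ true → colour a b ≡ colour b a
    colour-sym a b e = col-sym β (encode a) (encode b) (adj-encode a b e)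

    spread : ∀ a b₁ b₂ {d} (N : List Vertex) → (∀ w → adjV a w ≡ true → w ∈ N) → length N ≤ suc d →
             adjV a b₁ ≡ true → adjV a b₂ ≡ true → colour a b₂ ≤ colour a b₁ + d
    spread a b₁ b₂ N cover N≤ e₁ e₂ =
      interval-spread β int (≤-trans (degree-encode a N cover) N≤) (adj-encode a b₁ e₁) (adj-encode a b₂ e₂)

    root-spread : ∀ t₁ t₂ → colour root (hub t₂) ≤ colour root (hub t₁) + h′
    root-spread t₁ t₂ =
      spread root (hub t₁) (hub t₂) (map hub (allFin h)) cover (≤-reflexive (length-map-allFin hub)) refl refl
      where
      cover : ∀ w → adjV root w ≡ true → w ∈ map hub (allFin h)
      cover (hub t) _ = ∈-map⁺ hub (∈-allFin t)

    hub-spread : ∀ t b₁ b₂ → adjV (hub t) b₁ ≡ true → adjV (hub t) b₂ ≡ true →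
                 colour (hub t) b₂ ≤ colour (hub t) b₁ + k
    hub-spread t b₁ b₂ = spread (hub t) b₁ b₂ (root ∷ map (leaf t) (allFin k)) cover
                                (≤-reflexive (cong suc (length-map-allFin (leaf t))))
      where
      cover : ∀ w → adjV (hub t) w ≡ true → w ∈ root ∷ map (leaf t) (allFin k)
      cover root        _ = here refl
      cover (leaf t′ s) e = there (leaf∈leaves e)

    leaf-spread : ∀ t s b₁ b₂ → adjV (leaf t s) b₁ ≡ true → adjV (leaf t s) b₂ ≡ true →
                  colour (leaf t s) b₂ ≤ colour (leaf t s) b₁ + 1
    leaf-spread t s b₁ b₂ = spread (leaf t s) b₁ b₂ (hub t ∷ sink ∷ []) cover ≤-refl
      where
      cover : ∀ w → adjV (leaf t s) w ≡ true → w ∈ hub t ∷ sink ∷ []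
      cover (hub t′) e = here (cong hub (sym (hub∼leaf⇒≡ s e)))
      cover sink     _ = there (here refl)

    t₀ : Fin h
    t₀ = argmin (λ t → colour root (hub t)) zero (allFin h)

    M : ℕ
    M = colour root (hub t₀)

    M-min : ∀ t → M ≤ colour root (hub t)
    M-min t = All.lookup (f[argmin]≤f[xs] {f = λ t → colour root (hub t)} zero (allFin h)) (∈-allFin t)

    sink-above : ∀ t s → M ≤ colour sink (leaf t s) + suc k
    sink-above t s = begin
      M                               ≤⟨ M-min t ⟩
      colour root (hub t)             ≡⟨ colour-sym root (hub t) refl ⟩
      colour (hub t) root             ≤⟨ hub-spread t (leaf t s) root (hub∼leaf t s) refl ⟩
      colour (hub t) (leaf t s) + k   ≡⟨ cong (_+ k) (colour-sym (hub t) (leaf t s) (hub∼leaf t s)) ⟩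
      colour (leaf t s) (hub t) + k   ≤⟨ +-monoˡ-≤ k (leaf-spread t s sink (hub t) refl (hub∼leaf t s)) ⟩
      colour (leaf t s) sink + 1 + k  ≡⟨ cong (λ x → x + 1 + k) (colour-sym (leaf t s) sink refl) ⟩
      colour sink (leaf t s) + 1 + k  ≡⟨ +-assoc (colour sink (leaf t s)) 1 k ⟩
      colour sink (leaf t s) + suc k  ∎
      where open ≤-Reasoning

    sink-below : ∀ t s → colour sink (leaf t s) ≤ M + (h′ + suc k)
    sink-below t s = begin
      colour sink (leaf t s)          ≡⟨ colour-sym sink (leaf t s) refl ⟩
      colour (leaf t s) sink          ≤⟨ leaf-spread t s (hub t) sink (hub∼leaf t s) refl ⟩
      colour (leaf t s) (hub t) + 1   ≡⟨ cong (_+ 1) (colour-sym (leaf t s) (hub t) (hub∼leaf t s)) ⟩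
      colour (hub t) (leaf t s) + 1   ≤⟨ +-monoˡ-≤ 1 (hub-spread t root (leaf t s) refl (hub∼leaf t s)) ⟩
      colour (hub t) root + k + 1     ≡⟨ cong (λ x → x + k + 1) (colour-sym (hub t) root refl) ⟩
      colour root (hub t) + k + 1     ≤⟨ +-monoˡ-≤ 1 (+-monoˡ-≤ k (root-spread t₀ t)) ⟩
      M + h′ + k + 1                  ≡⟨ regroup M h′ k ⟩
      M + (h′ + suc k)                ∎
      where
      open ≤-Reasoning
      regroup : ∀ x y z → x + y + z + 1 ≡ x + (y + suc z)
      regroup = solve-∀

    inSinkWindow : Fin n → Bool
    inSinkWindow u = adj G (encode sink) u ∧ inRange (M ∸ suc k) sinkWindow (col β (encode sink) u)

    leaf-inSinkWindow : ∀ t s → inSinkWindow (encode (leaf t s)) ≡ true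
    leaf-inSinkWindow t s =
      cong₂ _∧_ (adj-encode sink (leaf t s) refl) (inRange-intro (M ∸ suc k) sinkWindow _ above below)
      where
      above : M ∸ suc k ≤ colour sink (leaf t s)
      above = m≤n+o⇒m∸n≤o M (suc k) (≤-trans (sink-above t s) (≤-reflexive (+-comm _ (suc k))))
      below : colour sink (leaf t s) ≤ M ∸ suc k + sinkWindow
      below = begin
        colour sink (leaf t s)              ≤⟨ sink-below t s ⟩
        M + (h′ + suc k)                    ≤⟨ +-monoˡ-≤ (h′ + suc k) (m≤n+m∸n M (suc k)) ⟩
        suc k + (M ∸ suc k) + (h′ + suc k)  ≡⟨ regroup (suc k) (M ∸ suc k) (h′ + suc k) ⟩
        M ∸ suc k + sinkWindow              ∎
        where
        open ≤-Reasoning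
        regroup : ∀ x y z → x + y + z ≡ y + (x + z)
        regroup = solve-∀

    sink-count-bound : h * k ≤ suc sinkWindow * j
    sink-count-bound = ≤-trans (count-allFin-↑ˡ (h * k) (suc (suc h)) inSinkWindow leaf-counted)
                               (improper-window β imp (encode sink) (M ∸ suc k) sinkWindow)
      where
      leaf-counted : ∀ i → inSinkWindow (i ↑ˡ suc (suc h)) ≡ true
      leaf-counted i = subst (λ u → inSinkWindow u ≡ true)
                             (cong (_↑ˡ suc (suc h)) (combine-remQuot {h} k i))
                             (leaf-inSinkWindow (proj₁ (remQuot {h} k i)) (proj₂ (remQuot {h} k i)))

overfull-identity : ∀ k′ → let h = suc (suc ((4 + 2 * k′) * k′)) in
                    suc (suc (suc k′) + (suc ((4 + 2 * k′) * k′) + suc (suc k′))) * k′ + 2 ≡ h * suc k′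
overfull-identity = solve-∀

theorem15 : ∀ (k : ℕ) → 1 ≤ k →
    Σ ℕ λ n → Σ (Graph n) λ G → IsBipartite G × μint≡ G k
theorem15 (suc k′) _ = n , G , bipartite , (α , α-improper , α-interval) , minimal
  where
  open Construction (suc ((4 + 2 * k′) * k′)) k′
  minimal : ∀ j → HasImproperInterval G j → k ≤ j
  minimal j (β , imp , int) = ≮⇒≥ λ j<k → <⇒≱ (overfull (s≤s⁻¹ j<k)) (sink-count-bound β imp int)
    where
    overfull : j ≤ k′ → suc sinkWindow * j < h * k
    overfull j≤k′ = begin-strict
      suc sinkWindow * j       ≤⟨ *-monoʳ-≤ (suc sinkWindow) j≤k′ ⟩
      suc sinkWindow * k′      <⟨ m<m+n _ z<s ⟩
      suc sinkWindow * k′ + 2  ≡⟨ overfull-identity k′ ⟩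
      h * k                    ∎
      where open ≤-Reasoning
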